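{- Let $n\ge 2$, $1\le h(1)\le n$, $h=(h(1),n,\ldots,n)$, and let $P_h$ be the poset on $[n]$ with $i<_{P_h}j$ iff $h(i)<j$. Let $\mu=(2,1^{n-2})$. Let $B_3$ be the set of formal expressions $x_n^{\ell_1}x_{n-1}^{\ell_2}\cdots x_2^{\ell_{n-1}}(y_k-y_1)$ with $0\le \ell_j\le n-1-j$ for all $j$, $2\le k\le n$, and such that $x_n^{\ell_1}\cdots x_2^{\ell_{n-1}}$ is not divisible by $\prod_{\ell=h(1)+1}^n x_\ell$ (so the exponent of $x_p$ is $\ell_{n+1-p}$ for $2\le p\le n$). Define $\varphi$ on $B_3$ by $\varphi(x_n^{\ell_1}\cdots x_2^{\ell_{n-1}}(y_k-y_1))=(S,T)$, where $S$ is the unique standard Young tableau of shape $\mu$ whose bottom row contains $1$ and $k$, and $T$ is built as follows: let $j$ be the largest element of $\{h(1)+1,\ldots,n\}$ with $\ell_{n+1-j}=0$; start with the bottom row consisting of $1$ (left) and $j$ (right); then for $i=2,3,\ldots,n$ in increasing order with $i\neq j$, insert a new box containing $i$ into the left column (the column whose bottom entry is $1$) so that exactly $(i-2)-\ell_{n+1-i}$ of the entries currently in the left column lie above it. Then $\varphi$ is a well-defined map from $B_3$ to the set of pairs $(S,T)$ with $S$ a standard Young tableau of shape $\mu$ and $T$ a $P_h$-tableau of shape $\mu$, and $\varphi$ is a bijection.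
   Context: Tableaux use the French convention: the Young diagram of $\mu=(2,1^{n-2})$ is a bottom row of two boxes with a column of $n-2$ boxes stacked above the left box. For a poset $P$ on $[n]$, a $P$-tableau of shape $\lambda$ is a filling using each element of $[n]$ exactly once such that if $j$ is directly to the right of $i$ then $j>_P i$, and if $j$ is directly above $i$ then $j\not<_P i$. A standard Young tableau is a $P$-tableau for the total order on $[n]$ (entries increase left to right and bottom to top). -}

module Defs where

open import Data.Nat using (ℕ; zero; suc; _+_; _∸_; _≤_; _<_; _≡ᵇ_)
open import Data.Nat.Properties using (_<?_; _≟_)
open import Relation.Nullary using (¬?)
open import Data.Bool using (Bool; true; false; if_then_else_)
open import Data.List using (List; []; _∷_; map; length; concat; upTo; filter; replicate)
open import Data.List.Relation.Unary.All using (All)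
open import Data.List.Relation.Unary.Linked using (Linked)
open import Data.List.Relation.Binary.Permutation.Propositional using (_↭_)
open import Data.Product using (_×_; _,_)
open import Data.Unit using (⊤)
open import Data.Empty using (⊥)
open import Relation.Nullary using (¬_)
open import Relation.Binary.PropositionalEquality using (_≡_)

-- Tableaux (French convention)
-- A filling of a shape is a list of rows, bottom row first; each row is
-- listed left to right.  A shape λ is the list of its row lengths,
-- bottom row first.

[1‥_] : ℕ → List ℕ
[1‥ n ] = map suc (upTo n)

VertOK : (ℕ → ℕ → Set) → List ℕ → List ℕ → Set
VertOK _<P_ _ [] = ⊤
VertOK _<P_ [] (u ∷ us) = ⊥
VertOK _<P_ (l ∷ ls) (u ∷ us) = (¬ (u <P l)) × VertOK _<P_ ls us

PTableau : (ℕ → ℕ → Set) → ℕ → List ℕ → List (List ℕ) → Set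
PTableau _<P_ n sh rows =
  (map length rows ≡ sh)
  × (concat rows ↭ [1‥ n ])
  × All (Linked (λ i j → i <P j)) rows      -- j directly right of i ⇒ i <P j
  × Linked (VertOK _<P_) rows               -- j directly above i ⇒ ¬ (j <P i)

SYT : ℕ → List ℕ → List (List ℕ) → Set
SYT n sh rows = PTableau _<_ n sh rows

μ : ℕ → List ℕ
μ n = 2 ∷ replicate (n ∸ 2) 1

hfun : ℕ → ℕ → ℕ → ℕ
hfun n h1 i = if i ≡ᵇ 1 then h1 else n

_<[P_,_]_ : ℕ → ℕ → ℕ → ℕ → Set
i <[P n , h1 ] j = hfun n h1 i < j

Ph : ℕ → ℕ → ℕ → ℕ → Set
Ph n h1 i j = i <[P n , h1 ] j

-- The set B_3.  An element x_n^{ℓ_1} ⋯ x_2^{ℓ_{n-1}} (y_k - y_1) is encoded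
-- by the list ls = ℓ_1 ∷ … ∷ ℓ_{n-1} ∷ [] together with k.

at : List ℕ → ℕ → ℕ
at [] _ = 0
at (x ∷ xs) zero = x
at (x ∷ xs) (suc i) = at xs i

ell : List ℕ → ℕ → ℕ
ell ls j = at ls (j ∸ 1)

expo : ℕ → List ℕ → ℕ → ℕ
expo n ls p = ell ls ((n + 1) ∸ p)

InB3 : ℕ → ℕ → List ℕ → ℕ → Set
InB3 n h1 ls k =
  (length ls ≡ n ∸ 1)
  × (∀ j → 1 ≤ j → j ≤ n ∸ 1 → ell ls j ≤ (n ∸ 1) ∸ j)
  × (2 ≤ k) × (k ≤ n)
  -- the monomial is not divisible by ∏_{p = h1+1}^{n} x_p
  × ¬ (∀ p → h1 < p → p ≤ n → 1 ≤ expo n ls p)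

lastOr : ℕ → List ℕ → ℕ
lastOr d [] = d
lastOr d (x ∷ xs) = lastOr x xs

jOf : ℕ → ℕ → List ℕ → ℕ
jOf n h1 ls = lastOr 0 (filter (λ p → expo n ls p ≟ 0) (filter (λ p → h1 <? p) [1‥ n ]))

-- insert x at 0-based position m (counted from the bottom) of a column
insertAt : ℕ → ℕ → List ℕ → List ℕ
insertAt zero x col = x ∷ col
insertAt (suc m) x [] = x ∷ []
insertAt (suc m) x (c ∷ col) = c ∷ insertAt m x col

-- process i = 2, 3, …, n; the column is listed bottom to top.
-- Inserting i so that exactly a = (i-2) - ℓ_{n+1-i} entries lie above it
-- means inserting at position (length col - a) from the bottom.
buildCol : ℕ → ℕ → List ℕ → List ℕ → List ℕ → List ℕ
buildCol n j ls [] col = col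
buildCol n j ls (i ∷ is) col =
  if i ≡ᵇ j then buildCol n j ls is col
  else buildCol n j ls is
         (insertAt (length col ∸ ((i ∸ 2) ∸ expo n ls i)) i col)

[2‥_] : ℕ → List ℕ
[2‥ n ] = map (λ t → suc (suc t)) (upTo (n ∸ 1))

singletons : List ℕ → List (List ℕ)
singletons = map (λ x → x ∷ [])

-- rows of a tableau of shape (2,1,…,1) from its bottom row a b and the
-- column (bottom to top) whose bottom entry is a
hookRows : ℕ → ℕ → List ℕ → List (List ℕ)
hookRows a b [] = (a ∷ b ∷ []) ∷ []
hookRows a b (_ ∷ rest) = (a ∷ b ∷ []) ∷ singletons rest

φS : ℕ → ℕ → List (List ℕ)
φS n k = (1 ∷ k ∷ []) ∷ singletons (filter (λ i → ¬? (i ≟ k)) [2‥ n ])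

φT : ℕ → ℕ → List ℕ → List (List ℕ)
φT n h1 ls = hookRows 1 j (buildCol n j ls [2‥ n ] (1 ∷ []))
  where j = jOf n h1 ls

φ : ℕ → ℕ → List ℕ → ℕ → List (List ℕ) × List (List ℕ)
φ n h1 ls k = φS n k , φT n h1 ls

module Submission where

-- A standard tableau of shape (2, 1ⁿ⁻²) is determined by the entry k next to 1, and a
-- P_h-tableau of that shape is a bottom row 1 j with h(1) < j ≤ n under an arbitrary
-- arrangement of [2, n] ∖ {j} in the column: h(i) = n for i ≥ 2 makes every vertical
-- condition vacuous.  The insertion rule places i below exactly (i - 2) - ℓ_{n+1-i} entries,
-- all smaller than i, and later insertions are larger than i, so in the finished column
-- ℓ_{n+1-i} is (i - 2) minus the number of smaller entries above i: the exponents are a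
-- Lehmer code of the column and are read back from it.  Conversely, inserting the entries
-- of any column at the depths read off it rebuilds the column.  Since j is missing from the
-- column, x_j gets exponent 0 and every x_p with p > j a positive one, so j is recovered as
-- the largest index beyond h(1) with zero exponent.

open import Defs
open import Data.Bool using (true; false; if_then_else_)
open import Data.Empty using (⊥-elim)
open import Data.List using (List; []; _∷_; [_]; _++_; _∷ʳ_; map; length; concat; filter; replicate; upTo; applyUpTo)
open import Data.List.Properties
  using (∷-injectiveˡ; ∷-injectiveʳ; ++-identityʳ; filter-accept; filter-reject; filter-all; filter-none; filter-++;
         length-map; length-upTo; length-applyUpTo; map-upTo)
open import Data.List.Membership.Propositional using (_∈_; _∉_)
open import Data.List.Membership.Propositional.Properties using (∈-filter⁺; ∈-filter⁻)
open import Data.List.Relation.Binary.Equality.Propositional using (≋⇒≡)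
open import Data.List.Relation.Binary.Permutation.Propositional
  using (_↭_; prep; swap; ↭-refl; ↭-sym; ↭-trans; ↭⇒↭ₛ; module PermutationReasoning)
open import Data.List.Relation.Binary.Permutation.Propositional.Properties
  using (filter-↭; ↭-length; drop-∷; ∷↭∷ʳ; All-resp-↭; ∈-resp-↭)
open import Data.List.Relation.Unary.All as All using (All; []; _∷_)
import Data.List.Relation.Unary.All.Properties as All
open import Data.List.Relation.Unary.All.Properties using (¬Any⇒All¬; All¬⇒¬Any)
open import Data.List.Relation.Unary.AllPairs as AllPairs using (AllPairs; []; _∷_)
import Data.List.Relation.Unary.AllPairs.Properties as AllPairs
open import Data.List.Relation.Unary.Any as Any using (Any; here; there; any?)
open import Data.List.Relation.Unary.Linked as Linked using (Linked; []; [-]; _∷_)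
import Data.List.Relation.Unary.Linked.Properties as Linked
open import Data.List.Relation.Unary.Sorted.TotalOrder.Properties using (↗↭↗⇒≋)
open import Data.List.Relation.Unary.Unique.Propositional using (Unique)
open import Data.Nat using (ℕ; zero; suc; _+_; _∸_; _≤_; _<_; _≡ᵇ_; z≤n; s≤s)
open import Data.Nat.Properties
open import Data.Product using (_×_; _,_; proj₁; proj₂; ∃-syntax)
open import Function using (_∘_)
open import Relation.Binary.Definitions using (tri<; tri≈; tri>)
open import Relation.Binary.PropositionalEquality
  using (_≡_; refl; sym; trans; cong; cong₂; subst; setoid; module ≡-Reasoning)
open import Relation.Nullary using (¬_; ¬?; yes; no; does)
open import Relation.Nullary.Decidable using (dec-true; dec-false)
open import Relation.Unary using (Pred; Decidable)
open import Data.List.Relation.Binary.Permutation.Setoid.Properties (setoid ℕ) using (Unique-resp-↭)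

-- Spelled as in φS, so that φS n k is definitionally hook 1 k ([2‥ n ] ∖ k).
_∖_ : List ℕ → ℕ → List ℕ
xs ∖ j = filter (λ i → ¬? (i ≟ j)) xs

∖-∉ : ∀ {j xs} → j ∉ xs → xs ∖ j ≡ xs
∖-∉ {j} {xs} j∉xs =
  filter-all (λ i → ¬? (i ≟ j)) (All.tabulate λ x∈xs x≡j → j∉xs (subst (_∈ xs) x≡j x∈xs))

∷ʳ-∖-≢ : ∀ {i j} xs → ¬ i ≡ j → (xs ∷ʳ i) ∖ j ≡ (xs ∖ j) ∷ʳ i
∷ʳ-∖-≢ {i} {j} xs i≢j =
  trans (filter-++ (λ x → ¬? (x ≟ j)) xs [ i ]) (cong ((xs ∖ j) ++_) (filter-accept (λ x → ¬? (x ≟ j)) i≢j))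

∷ʳ-∖-≡ : ∀ {j} xs → (xs ∷ʳ j) ∖ j ≡ xs ∖ j
∷ʳ-∖-≡ {j} xs = begin
  (xs ∷ʳ j) ∖ j        ≡⟨ filter-++ (λ x → ¬? (x ≟ j)) xs [ j ] ⟩
  xs ∖ j ++ [ j ] ∖ j  ≡⟨ cong ((xs ∖ j) ++_) (filter-reject (λ x → ¬? (x ≟ j)) (λ j≢j → j≢j refl)) ⟩
  xs ∖ j ++ []         ≡⟨ ++-identityʳ (xs ∖ j) ⟩
  xs ∖ j               ∎
  where open ≡-Reasoning

countSmaller : ℕ → List ℕ → ℕ
countSmaller x xs = length (filter (_<? x) xs)

countSmaller-↭ : ∀ x {xs ys} → xs ↭ ys → countSmaller x xs ≡ countSmaller x ys
countSmaller-↭ x p = ↭-length (filter-↭ (_<? x) p)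

countSmaller-accept : ∀ {x c} cs → c < x → countSmaller x (c ∷ cs) ≡ suc (countSmaller x cs)
countSmaller-accept cs c<x = cong length (filter-accept (_<? _) c<x)

countSmaller-reject : ∀ {x c} cs → ¬ c < x → countSmaller x (c ∷ cs) ≡ countSmaller x cs
countSmaller-reject cs c≮x = cong length (filter-reject (_<? _) c≮x)

countSmaller-≤-∷ : ∀ x c cs → countSmaller x cs ≤ countSmaller x (c ∷ cs)
countSmaller-≤-∷ x c cs with does (c <? x)
... | true  = n≤1+n _
... | false = ≤-refl

range : ℕ → ℕ → List ℕ
range k zero    = []
range k (suc m) = k ∷ range (suc k) m

applyUpTo≡range : ∀ (f : ℕ → ℕ) k m → (∀ t → f t ≡ k + t) → applyUpTo f m ≡ range k m
applyUpTo≡range f k zero    f≗ = refl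
applyUpTo≡range f k (suc m) f≗ = cong₂ _∷_ (trans (f≗ 0) (+-identityʳ k))
  (applyUpTo≡range (f ∘ suc) (suc k) m (λ t → trans (f≗ (suc t)) (+-suc k t)))

range-∷ʳ : ∀ k m → range k (suc m) ≡ range k m ∷ʳ (k + m)
range-∷ʳ k zero    = cong [_] (sym (+-identityʳ k))
range-∷ʳ k (suc m) = cong (k ∷_) (trans (range-∷ʳ (suc k) m) (cong (range (suc k) m ∷ʳ_) (sym (+-suc k m))))

length-range : ∀ k m → length (range k m) ≡ m
length-range k zero    = refl
length-range k (suc m) = cong (suc) (length-range (suc k) m)

range-bounded : ∀ k m → All (λ x → k ≤ x × x < k + m) (range k m)
range-bounded k zero    = []
range-bounded k (suc m) = (≤-refl , k<k+sm) ∷ All.map weaken (range-bounded (suc k) m)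
  where
  k<k+sm : k < k + suc m
  k<k+sm = subst (k <_) (sym (+-suc k m)) (s≤s (m≤m+n k m))
  weaken : ∀ {x} → suc k ≤ x × x < suc k + m → k ≤ x × x < k + suc m
  weaken {x} (sk≤x , x<) = <⇒≤ sk≤x , subst (x <_) (sym (+-suc k m)) x<

range-increasing : ∀ k m → Linked _<_ (range k m)
range-increasing k zero          = []
range-increasing k (suc zero)    = [-]
range-increasing k (suc (suc m)) = ≤-refl ∷ range-increasing (suc k) (suc m)

∈-range⁺ : ∀ {x} k m → k ≤ x → x < k + m → x ∈ range k m
∈-range⁺ k zero    k≤x x< = ⊥-elim (<-irrefl refl (≤-trans x< (subst (_≤ _) (sym (+-identityʳ k)) k≤x)))
∈-range⁺ {x} k (suc m) k≤x x< with k ≟ x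
... | yes refl = here refl
... | no  k≢x  = there (∈-range⁺ (suc k) m (≤∧≢⇒< k≤x k≢x) (subst (x <_) (+-suc k m) x<))

∈-range⁻ : ∀ {x} k m → x ∈ range k m → k ≤ x × x < k + m
∈-range⁻ k m x∈ = All.lookup (range-bounded k m) x∈

countSmaller-range : ∀ k m p → p ≤ k + m → countSmaller p (range k m) ≡ p ∸ k
countSmaller-range k zero    p p≤ = sym (m≤n⇒m∸n≡0 (subst (p ≤_) (+-identityʳ k) p≤))
countSmaller-range k (suc m) p p≤ with k <? p
... | yes k<p = begin
  countSmaller p (range k (suc m))        ≡⟨ countSmaller-accept (range (suc k) m) k<p ⟩
  suc (countSmaller p (range (suc k) m))  ≡⟨ cong suc (countSmaller-range (suc k) m p (subst (p ≤_) (+-suc k m) p≤)) ⟩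
  suc (p ∸ suc k)                         ≡⟨ sym (+-∸-assoc 1 k<p) ⟩
  p ∸ k                                   ∎
  where open ≡-Reasoning
... | no  k≮p = begin
  countSmaller p (range k (suc m))  ≡⟨ countSmaller-reject (range (suc k) m) k≮p ⟩
  countSmaller p (range (suc k) m)  ≡⟨ countSmaller-range (suc k) m p (subst (p ≤_) (+-suc k m) p≤) ⟩
  p ∸ suc k                         ≡⟨ m≤n⇒m∸n≡0 (m≤n⇒m≤1+n (≮⇒≥ k≮p)) ⟩
  0                                 ≡⟨ sym (m≤n⇒m∸n≡0 (≮⇒≥ k≮p)) ⟩
  p ∸ k                             ∎
  where open ≡-Reasoning

∷-range-∖-↭ : ∀ k m j → k ≤ j → j < k + m → j ∷ range k m ∖ j ↭ range k m
∷-range-∖-↭ k zero    j k≤j j< = ⊥-elim (<-irrefl refl (≤-trans j< (subst (_≤ j) (sym (+-identityʳ k)) k≤j)))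
∷-range-∖-↭ k (suc m) j k≤j j< with k ≟ j
... | yes refl rewrite filter-reject (λ i → ¬? (i ≟ k)) {k} {range (suc k) m} (λ k≢k → k≢k refl)
                     | ∖-∉ (λ k∈ → <-irrefl refl (proj₁ (∈-range⁻ (suc k) m k∈))) = ↭-refl
... | no  k≢j  rewrite filter-accept (λ i → ¬? (i ≟ j)) {k} {range (suc k) m} k≢j =
  ↭-trans (swap j k ↭-refl) (prep k (∷-range-∖-↭ (suc k) m j (≤∧≢⇒< k≤j k≢j) (subst (j <_) (+-suc k m) j<)))

length-range-∖-∈ : ∀ k m j → k ≤ j → j < k + m → suc (length (range k m ∖ j)) ≡ m
length-range-∖-∈ k m j k≤j j< = trans (↭-length (∷-range-∖-↭ k m j k≤j j<)) (length-range k m)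

range-∖-∉ : ∀ k m j → k + m ≤ j → range k m ∖ j ≡ range k m
range-∖-∉ k m j k+m≤j = ∖-∉ (λ j∈ → <⇒≱ (proj₂ (∈-range⁻ k m j∈)) k+m≤j)

insertAt-↭ : ∀ m x col → insertAt m x col ↭ x ∷ col
insertAt-↭ zero    x col       = ↭-refl
insertAt-↭ (suc m) x []        = ↭-refl
insertAt-↭ (suc m) x (c ∷ col) = ↭-trans (prep c (insertAt-↭ m x col)) (swap c x ↭-refl)

filter-insertAt-reject : ∀ y m {x} col → ¬ x < y → filter (_<? y) (insertAt m x col) ≡ filter (_<? y) col
filter-insertAt-reject y zero    col       x≮y = filter-reject (_<? y) x≮y
filter-insertAt-reject y (suc m) []        x≮y = filter-reject (_<? y) x≮y
filter-insertAt-reject y (suc m) (c ∷ col) x≮y with does (c <? y)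
... | true  = cong (c ∷_) (filter-insertAt-reject y m col x≮y)
... | false = filter-insertAt-reject y m col x≮y

smallerAbove : ℕ → List ℕ → ℕ
smallerAbove x []       = 0
smallerAbove x (c ∷ cs) with c ≟ x
... | yes _ = countSmaller x cs
... | no  _ = smallerAbove x cs

smallerAbove≤countSmaller : ∀ x cs → smallerAbove x cs ≤ countSmaller x cs
smallerAbove≤countSmaller x []       = z≤n
smallerAbove≤countSmaller x (c ∷ cs) with c ≟ x
... | yes _ = countSmaller-≤-∷ x c cs
... | no  _ = ≤-trans (smallerAbove≤countSmaller x cs) (countSmaller-≤-∷ x c cs)

smallerAbove-insertAt-self : ∀ m x col → All (_< x) col → m ≤ length col →
                             smallerAbove x (insertAt m x col) ≡ length col ∸ m
smallerAbove-insertAt-self zero x col col<x _ with x ≟ x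
... | yes _   = cong length (filter-all (_<? x) col<x)
... | no  x≢x = ⊥-elim (x≢x refl)
smallerAbove-insertAt-self (suc m) x (c ∷ col) (c<x ∷ col<x) (s≤s m≤) with c ≟ x
... | yes refl = ⊥-elim (<-irrefl refl c<x)
... | no  _    = smallerAbove-insertAt-self m x col col<x m≤

smallerAbove-∷-≢ : ∀ {x c} cs → ¬ c ≡ x → smallerAbove x (c ∷ cs) ≡ smallerAbove x cs
smallerAbove-∷-≢ {x} {c} cs c≢x with c ≟ x
... | yes c≡x = ⊥-elim (c≢x c≡x)
... | no  _   = refl

smallerAbove-insertAt-other : ∀ y m x col → ¬ y ≡ x → ¬ x < y →
                              smallerAbove y (insertAt m x col) ≡ smallerAbove y col
smallerAbove-insertAt-other y zero    x col       y≢x x≮y = smallerAbove-∷-≢ col (y≢x ∘ sym)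
smallerAbove-insertAt-other y (suc m) x []        y≢x x≮y = smallerAbove-∷-≢ [] (y≢x ∘ sym)
smallerAbove-insertAt-other y (suc m) x (c ∷ col) y≢x x≮y with c ≟ y
... | yes _ = cong length (filter-insertAt-reject y m col x≮y)
... | no  _ = smallerAbove-insertAt-other y m x col y≢x x≮y

filter-<-suc-∉ : ∀ x xs → x ∉ xs → filter (_<? suc x) xs ≡ filter (_<? x) xs
filter-<-suc-∉ x []       x∉ = refl
filter-<-suc-∉ x (y ∷ ys) x∉ with y <? x
... | yes y<x rewrite filter-accept (_<? suc x) {y} {ys} (m<n⇒m<1+n y<x) | filter-accept (_<? x) {y} {ys} y<x
  = cong (y ∷_) (filter-<-suc-∉ x ys (x∉ ∘ there))
... | no  y≮x
  rewrite filter-reject (_<? suc x) {y} {ys} (λ y<sx → y≮x (≤∧≢⇒< (≤-pred y<sx) (λ y≡x → x∉ (here (sym y≡x)))))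
                    | filter-reject (_<? x) {y} {ys} y≮x
  = filter-<-suc-∉ x ys (x∉ ∘ there)

filter-<-suc≡insertAt : ∀ x xs → x ∈ xs → Unique xs →
  filter (_<? suc x) xs ≡ insertAt (countSmaller x xs ∸ smallerAbove x xs) x (filter (_<? x) xs)
filter-<-suc≡insertAt x (c ∷ cs) x∈ (c≢cs ∷ cs-unique) with c ≟ x
... | yes refl
  rewrite filter-accept (_<? suc c) {c} {cs} ≤-refl
        | filter-reject (_<? c) {c} {cs} (<-irrefl refl)
        | n∸n≡0 (countSmaller c cs)
  = cong (c ∷_) (filter-<-suc-∉ c cs (All¬⇒¬Any c≢cs))
filter-<-suc≡insertAt x (c ∷ cs) (here x≡c)  _ | no c≢x = ⊥-elim (c≢x (sym x≡c))
filter-<-suc≡insertAt x (c ∷ cs) (there x∈) (_ ∷ cs-unique) | no c≢x with c <? x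
... | yes c<x
  rewrite filter-accept (_<? suc x) {c} {cs} (m<n⇒m<1+n c<x)
        | filter-accept (_<? x) {c} {cs} c<x
        | +-∸-assoc 1 (smallerAbove≤countSmaller x cs)
  = cong (c ∷_) (filter-<-suc≡insertAt x cs x∈ cs-unique)
... | no c≮x
  rewrite filter-reject (_<? suc x) {c} {cs} (λ c<sx → c≮x (≤∧≢⇒< (≤-pred c<sx) c≢x))
        | filter-reject (_<? x) {c} {cs} c≮x
  = filter-<-suc≡insertAt x cs x∈ cs-unique

Largest : ∀ {ℓ} → Pred ℕ ℓ → List ℕ → ℕ → Set ℓ
Largest P xs m = m ∈ xs × P m × (∀ {y} → y ∈ xs → m < y → ¬ P y)

Largest-unique : ∀ {ℓ} {P : Pred ℕ ℓ} {xs m m′} → Largest P xs m → Largest P xs m′ → m ≡ m′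
Largest-unique {m = m} {m′} (m∈ , Pm , m-largest) (m′∈ , Pm′ , m′-largest) with <-cmp m m′
... | tri< m<m′ _ _ = ⊥-elim (m-largest m′∈ m<m′ Pm′)
... | tri≈ _ m≡m′ _ = m≡m′
... | tri> _ _ m′<m = ⊥-elim (m′-largest m∈ m′<m Pm)

module _ {ℓ} {P : Pred ℕ ℓ} (P? : Decidable P) where

  lastOr-filter-Largest : ∀ d {xs} → AllPairs _<_ xs → Any P xs → Largest P xs (lastOr d (filter P? xs))
  lastOr-filter-Largest d {x ∷ xs} (x<xs ∷ xs<) any-x∷xs with P? x | any? P? xs
  ... | yes Px | yes any-xs =
    let m∈ , Pm , m-largest = lastOr-filter-Largest x xs< any-xs
    in there m∈ , Pm , λ { (here refl) m<x → ⊥-elim (<-asym m<x (All.lookup x<xs m∈))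
                         ; (there y∈)     → m-largest y∈ }
  ... | yes Px | no ¬any-xs rewrite filter-none P? (¬Any⇒All¬ xs ¬any-xs) =
    here refl , Px , λ { (here refl) x<x → ⊥-elim (<-irrefl refl x<x)
                       ; (there y∈) _ → All.lookup (¬Any⇒All¬ xs ¬any-xs) y∈ }
  ... | no ¬Px | _ with any-x∷xs
  ...   | here Px       = ⊥-elim (¬Px Px)
  ...   | there any-xs =
    let m∈ , Pm , m-largest = lastOr-filter-Largest d xs< any-xs
    in there m∈ , Pm , λ { (here refl) _ → ¬Px ; (there y∈) → m-largest y∈ }

  lastOr-filter≡Largest : ∀ d {xs m} → AllPairs _<_ xs → Largest P xs m → lastOr d (filter P? xs) ≡ m
  lastOr-filter≡Largest d xs< m-largest@(m∈ , Pm , _) =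
    Largest-unique (lastOr-filter-Largest d xs< (Any.map (λ { refl → Pm }) m∈)) m-largest

-- Tableaux of hook shape (2, 1ⁿ⁻²)

hook : ℕ → ℕ → List ℕ → List (List ℕ)
hook a b cs = (a ∷ b ∷ []) ∷ singletons cs

concat-singletons : ∀ xs → concat (singletons xs) ≡ xs
concat-singletons []       = refl
concat-singletons (x ∷ xs) = cong (x ∷_) (concat-singletons xs)

map-length-singletons : ∀ xs → map length (singletons xs) ≡ replicate (length xs) 1
map-length-singletons []       = refl
map-length-singletons (x ∷ xs) = cong (1 ∷_) (map-length-singletons xs)

map-length≡replicate⇒singletons : ∀ rows k → map length rows ≡ replicate k 1 → ∃[ cs ] rows ≡ singletons cs
map-length≡replicate⇒singletons []               k       _  = [] , refl
map-length≡replicate⇒singletons ((x ∷ []) ∷ rows) (suc k) eq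
  with cs , refl ← map-length≡replicate⇒singletons rows k (∷-injectiveʳ eq) = x ∷ cs , refl

μ-shaped⇒hook : ∀ n rows → map length rows ≡ μ n → ∃[ a ] ∃[ b ] ∃[ cs ] rows ≡ hook a b cs
μ-shaped⇒hook n ((a ∷ b ∷ []) ∷ rows) eq
  with cs , refl ← map-length≡replicate⇒singletons rows (n ∸ 2) (∷-injectiveʳ eq) = a , b , cs , refl

module _ {R : ℕ → ℕ → Set} where

  VertOK-singletons⁺ : ∀ {xs} → Linked (λ x y → ¬ R y x) xs → Linked (VertOK R) (singletons xs)
  VertOK-singletons⁺ []       = []
  VertOK-singletons⁺ [-]      = [-]
  VertOK-singletons⁺ (r ∷ rs) = (r , _) ∷ VertOK-singletons⁺ rs

  VertOK-singletons⁻ : ∀ xs → Linked (VertOK R) (singletons xs) → Linked (λ x y → ¬ R y x) xs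
  VertOK-singletons⁻ []           _             = []
  VertOK-singletons⁻ (x ∷ [])     _             = [-]
  VertOK-singletons⁻ (x ∷ y ∷ xs) ((r , _) ∷ rs) = r ∷ VertOK-singletons⁻ (y ∷ xs) rs

  VertOK-hook⁺ : ∀ {a b cs} → Linked (λ x y → ¬ R y x) (a ∷ cs) → Linked (VertOK R) (hook a b cs)
  VertOK-hook⁺ [-]      = [-]
  VertOK-hook⁺ (r ∷ rs) = (r , _) ∷ VertOK-singletons⁺ rs

  VertOK-hook⁻ : ∀ {a b} cs → Linked (VertOK R) (hook a b cs) → Linked (λ x y → ¬ R y x) (a ∷ cs)
  VertOK-hook⁻ []       _             = [-]
  VertOK-hook⁻ (c ∷ cs) ((r , _) ∷ rs) = r ∷ VertOK-singletons⁻ (c ∷ cs) rs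

  All-Linked-singletons : ∀ xs → All (Linked R) (singletons xs)
  All-Linked-singletons []       = []
  All-Linked-singletons (x ∷ xs) = [-] ∷ All-Linked-singletons xs

  PTableau-hook⁺ : ∀ n {a b cs} → a ∷ b ∷ cs ↭ [1‥ n ] → R a b → Linked (λ x y → ¬ R y x) (a ∷ cs) →
                   PTableau R n (μ n) (hook a b cs)
  PTableau-hook⁺ n {a} {b} {cs} perm Rab vert =
    shape , entries , (Rab ∷ [-]) ∷ All-Linked-singletons cs , VertOK-hook⁺ vert
    where
    length-cs : length cs ≡ n ∸ 2
    length-cs = cong (_∸ 2) (trans (↭-length perm) (trans (length-map suc (upTo n)) (length-upTo n)))
    shape : map length (hook a b cs) ≡ μ n
    shape = cong (2 ∷_) (trans (map-length-singletons cs) (cong (λ k → replicate k 1) length-cs))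
    entries : concat (hook a b cs) ↭ [1‥ n ]
    entries = subst (λ zs → a ∷ b ∷ zs ↭ [1‥ n ]) (sym (concat-singletons cs)) perm

  PTableau-hook⁻ : ∀ n {a b} cs → PTableau R n (μ n) (hook a b cs) →
                   (a ∷ b ∷ cs ↭ [1‥ n ]) × R a b × Linked (λ x y → ¬ R y x) (a ∷ cs)
  PTableau-hook⁻ n {a} {b} cs (_ , entries , (Rab ∷ [-]) ∷ _ , vert) =
    subst (λ zs → a ∷ b ∷ zs ↭ [1‥ n ]) (concat-singletons cs) entries , Rab , VertOK-hook⁻ cs vert

[1‥]≡range : ∀ n → [1‥ n ] ≡ range 1 n
[1‥]≡range n = trans (map-upTo suc n) (applyUpTo≡range suc 1 n (λ _ → refl))

[2‥]≡range : ∀ n → [2‥ n ] ≡ range 2 (n ∸ 1)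
[2‥]≡range n = trans (map-upTo (suc ∘ suc) (n ∸ 1)) (applyUpTo≡range (suc ∘ suc) 2 (n ∸ 1) (λ _ → refl))

∈-[1‥]⁻ : ∀ {x} n → x ∈ [1‥ n ] → 1 ≤ x × x ≤ n
∈-[1‥]⁻ n x∈ with 1≤x , x<1+n ← ∈-range⁻ 1 n (subst (_ ∈_) ([1‥]≡range n) x∈) = 1≤x , ≤-pred x<1+n

∈-[1‥]⁺ : ∀ {x} n → 1 ≤ x → x ≤ n → x ∈ [1‥ n ]
∈-[1‥]⁺ n 1≤x x≤n = subst (_ ∈_) (sym ([1‥]≡range n)) (∈-range⁺ 1 n 1≤x (s≤s x≤n))

[1‥]-increasing : ∀ n → AllPairs _<_ [1‥ n ]
[1‥]-increasing n = subst (AllPairs _<_) (sym ([1‥]≡range n)) (Linked.Linked⇒AllPairs <-trans (range-increasing 1 n))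

2+[n∸1]≡1+n : ∀ {n} → 1 ≤ n → 2 + (n ∸ 1) ≡ suc n
2+[n∸1]≡1+n 1≤n = cong suc (m+[n∸m]≡n 1≤n)

module _ {n} (1≤n : 1 ≤ n) where

  private
    range-[2‥] : range 2 (n ∸ 1) ≡ [2‥ n ]
    range-[2‥] = sym ([2‥]≡range n)

  [1‥]≡1∷[2‥] : [1‥ n ] ≡ 1 ∷ [2‥ n ]
  [1‥]≡1∷[2‥] = begin
    [1‥ n ]              ≡⟨ [1‥]≡range n ⟩
    range 1 n            ≡⟨ cong (range 1) (sym (m+[n∸m]≡n 1≤n)) ⟩
    1 ∷ range 2 (n ∸ 1)  ≡⟨ cong (1 ∷_) range-[2‥] ⟩
    1 ∷ [2‥ n ]          ∎
    where open ≡-Reasoning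

  ∈-[2‥]⁺ : ∀ {x} → 2 ≤ x → x ≤ n → x ∈ [2‥ n ]
  ∈-[2‥]⁺ {x} 2≤x x≤n =
    subst (x ∈_) range-[2‥] (∈-range⁺ 2 (n ∸ 1) 2≤x (subst (x <_) (sym (2+[n∸1]≡1+n 1≤n)) (s≤s x≤n)))

  [2‥]-bounded : All (λ x → 2 ≤ x × x ≤ n) [2‥ n ]
  [2‥]-bounded = subst (All _) range-[2‥]
    (All.map (λ {x} (2≤x , x<) → 2≤x , ≤-pred (subst (x <_) (2+[n∸1]≡1+n 1≤n) x<)) (range-bounded 2 (n ∸ 1)))

  [2‥]-increasing : AllPairs _<_ [2‥ n ]
  [2‥]-increasing = subst (AllPairs _<_) range-[2‥] (Linked.Linked⇒AllPairs <-trans (range-increasing 2 (n ∸ 1)))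

  countSmaller-[2‥] : ∀ p → p ≤ suc n → countSmaller p [2‥ n ] ≡ p ∸ 2
  countSmaller-[2‥] p p≤ = subst (λ xs → countSmaller p xs ≡ p ∸ 2) range-[2‥]
    (countSmaller-range 2 (n ∸ 1) p (subst (p ≤_) (sym (2+[n∸1]≡1+n 1≤n)) p≤))

  ∷-[2‥]∖-↭ : ∀ {j} → 2 ≤ j → j ≤ n → j ∷ [2‥ n ] ∖ j ↭ [2‥ n ]
  ∷-[2‥]∖-↭ {j} 2≤j j≤n = subst (λ xs → j ∷ xs ∖ j ↭ xs) range-[2‥]
    (∷-range-∖-↭ 2 (n ∸ 1) j 2≤j (subst (j <_) (sym (2+[n∸1]≡1+n 1≤n)) (s≤s j≤n)))

  ↭-[1‥]⁺ : ∀ {j ds} → 2 ≤ j → j ≤ n → ds ↭ [2‥ n ] ∖ j → 1 ∷ j ∷ ds ↭ [1‥ n ]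
  ↭-[1‥]⁺ {j} 2≤j j≤n ds↭ = subst (1 ∷ j ∷ _ ↭_) (sym [1‥]≡1∷[2‥])
    (prep 1 (↭-trans (prep j ds↭) (∷-[2‥]∖-↭ 2≤j j≤n)))

  ↭-[1‥]⁻ : ∀ {j ds} → 2 ≤ j → j ≤ n → 1 ∷ j ∷ ds ↭ [1‥ n ] → ds ↭ [2‥ n ] ∖ j
  ↭-[1‥]⁻ 2≤j j≤n perm =
    drop-∷ (↭-trans (drop-∷ (subst (1 ∷ _ ↭_) [1‥]≡1∷[2‥] perm)) (↭-sym (∷-[2‥]∖-↭ 2≤j j≤n)))

  module _ (j : ℕ) where

    [2‥]∖-bounded : All (λ x → 2 ≤ x × x ≤ n) ([2‥ n ] ∖ j)
    [2‥]∖-bounded = All.filter⁺ _ [2‥]-bounded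

    [2‥]∖-increasing : AllPairs _<_ ([2‥ n ] ∖ j)
    [2‥]∖-increasing = AllPairs.filter⁺ _ [2‥]-increasing

    [2‥]∖-unique : Unique ([2‥ n ] ∖ j)
    [2‥]∖-unique = AllPairs.map (λ x<y x≡y → <-irrefl x≡y x<y) [2‥]∖-increasing

    j∉[2‥]∖j : j ∉ [2‥ n ] ∖ j
    j∉[2‥]∖j = All¬⇒¬Any (All.map (_∘ sym) (All.all-filter _ [2‥ n ]))

    countSmaller-∷-[2‥]∖ : 2 ≤ j → j ≤ n → ∀ p → p ≤ suc n → countSmaller p (j ∷ [2‥ n ] ∖ j) ≡ p ∸ 2
    countSmaller-∷-[2‥]∖ 2≤j j≤n p p≤ =
      trans (countSmaller-↭ p (∷-[2‥]∖-↭ 2≤j j≤n)) (countSmaller-[2‥] p p≤)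

  φS-SYT : ∀ {k} → 2 ≤ k → k ≤ n → SYT n (μ n) (φS n k)
  φS-SYT {k} 2≤k k≤n = PTableau-hook⁺ n (↭-[1‥]⁺ 2≤k k≤n ↭-refl) 2≤k
    (Linked.map <-asym (Linked.AllPairs⇒Linked (All.map proj₁ ([2‥]∖-bounded k) ∷ [2‥]∖-increasing k)))

  bottom-right≤n : ∀ {a b cs} → a ∷ b ∷ cs ↭ [1‥ n ] → b ≤ n
  bottom-right≤n perm = proj₂ (∈-[1‥]⁻ n (∈-resp-↭ perm (there (here refl))))

  least-of-[1‥]≡1 : ∀ {a xs} → xs ↭ [1‥ n ] → a ∈ xs → All (a ≤_) xs → a ≡ 1
  least-of-[1‥]≡1 perm a∈ a≤xs =
    ≤-antisym (All.lookup a≤xs (∈-resp-↭ (↭-sym perm) (∈-[1‥]⁺ n ≤-refl 1≤n)))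
              (proj₁ (∈-[1‥]⁻ n (∈-resp-↭ perm a∈)))

  SYT⇒φS : ∀ S → SYT n (μ n) S → ∃[ k ] 2 ≤ k × k ≤ n × S ≡ φS n k
  SYT⇒φS S S-SYT@(shape , _) with a , b , cs , refl ← μ-shaped⇒hook n S shape
    with perm , a<b , vert ← PTableau-hook⁻ n cs S-SYT
    with sorted ← Linked.map ≮⇒≥ vert
    with refl ← least-of-[1‥]≡1 perm (here refl)
                  (≤-refl ∷ <⇒≤ a<b ∷ AllPairs.head (Linked.Linked⇒AllPairs ≤-trans sorted))
    = b , a<b , b≤n , cong (hook 1 b) cs≡[2‥]∖b
    where
    b≤n : b ≤ n
    b≤n = bottom-right≤n perm
    cs≡[2‥]∖b : cs ≡ [2‥ n ] ∖ b
    cs≡[2‥]∖b = ≋⇒≡ (↗↭↗⇒≋ ≤-totalOrder (Linked.tail sorted)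
      (Linked.map <⇒≤ (Linked.AllPairs⇒Linked ([2‥]∖-increasing b))) (↭⇒↭ₛ (↭-[1‥]⁻ a<b b≤n perm)))

-- P_h-tableaux and the index j

hfun-≢1 : ∀ n h1 {c} → ¬ c ≡ 1 → hfun n h1 c ≡ n
hfun-≢1 n h1 {c} c≢1 rewrite dec-false (c ≟ 1) c≢1 = refl

module _ {n h1} (1≤n : 1 ≤ n) (1≤h1 : 1 ≤ h1) where

  hook-PhTableau : ∀ {j ds} → h1 < j → j ≤ n → ds ↭ [2‥ n ] ∖ j → PTableau (Ph n h1) n (μ n) (hook 1 j ds)
  hook-PhTableau {j} h1<j j≤n ds↭ = PTableau-hook⁺ n (↭-[1‥]⁺ 1≤n (≤-trans (s≤s 1≤h1) h1<j) j≤n ds↭) h1<j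
    (column-ok 1≤n (All-resp-↭ (↭-sym ds↭) ([2‥]∖-bounded 1≤n j)))
    where
    column-ok : ∀ {x ys} → x ≤ n → All (λ y → 2 ≤ y × y ≤ n) ys → Linked (λ a b → ¬ Ph n h1 b a) (x ∷ ys)
    column-ok _   []                   = [-]
    column-ok x≤n ((2≤y , y≤n) ∷ ys-ok) =
      (λ hy<x → <⇒≱ (subst (_< _) (hfun-≢1 n h1 (λ y≡1 → <-irrefl (sym y≡1) 2≤y)) hy<x) x≤n)
      ∷ column-ok y≤n ys-ok

  PhTableau⇒hook : ∀ T → PTableau (Ph n h1) n (μ n) T →
                   ∃[ j ] ∃[ ds ] h1 < j × j ≤ n × ds ↭ [2‥ n ] ∖ j × T ≡ hook 1 j ds
  PhTableau⇒hook T T-Ph@(shape , _) with a , b , cs , refl ← μ-shaped⇒hook n T shape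
    with perm , ha<b , _ ← PTableau-hook⁻ n cs T-Ph
    with a ≟ 1
  ... | no  a≢1  = ⊥-elim (<⇒≱ (subst (_< b) (hfun-≢1 n h1 a≢1) ha<b) (bottom-right≤n 1≤n perm))
  ... | yes refl = b , cs , ha<b , bottom-right≤n 1≤n perm ,
                   ↭-[1‥]⁻ 1≤n (≤-trans (s≤s 1≤h1) ha<b) (bottom-right≤n 1≤n perm) perm , refl

-- The list searched by jOf, so that jOf n h1 ls is definitionally a lastOr of a filter of it.
candidates : ℕ → ℕ → List ℕ
candidates n h1 = filter (λ p → h1 <? p) [1‥ n ]

∈-candidates⁺ : ∀ {n h1 p} → h1 < p → p ≤ n → p ∈ candidates n h1
∈-candidates⁺ {n} h1<p p≤n = ∈-filter⁺ _ (∈-[1‥]⁺ n (≤-trans (s≤s z≤n) h1<p) p≤n) h1<p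

∈-candidates⁻ : ∀ {n h1 p} → p ∈ candidates n h1 → h1 < p × p ≤ n
∈-candidates⁻ {n} p∈ with p∈[1‥] , h1<p ← ∈-filter⁻ _ p∈ = h1<p , proj₂ (∈-[1‥]⁻ n p∈[1‥])

candidates-increasing : ∀ n h1 → AllPairs _<_ (candidates n h1)
candidates-increasing n h1 = AllPairs.filter⁺ _ ([1‥]-increasing n)

ZeroExponent : ℕ → List ℕ → ℕ → Set
ZeroExponent n ls p = expo n ls p ≡ 0

jOf-Largest : ∀ {n h1 ls k} → InB3 n h1 ls k → Largest (ZeroExponent n ls) (candidates n h1) (jOf n h1 ls)
jOf-Largest {n} {h1} {ls} (_ , _ , _ , _ , not-divisible) =
  lastOr-filter-Largest (λ p → expo n ls p ≟ 0) 0 (candidates-increasing n h1) some-zero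
  where
  some-zero : Any (ZeroExponent n ls) (candidates n h1)
  some-zero with any? (λ p → expo n ls p ≟ 0) (candidates n h1)
  ... | yes any = any
  ... | no ¬any = ⊥-elim (not-divisible λ p h1<p p≤n →
          n≢0⇒n>0 (All.lookup (¬Any⇒All¬ _ ¬any) (∈-candidates⁺ h1<p p≤n)))

jOf≡Largest : ∀ {n h1 ls j} → Largest (ZeroExponent n ls) (candidates n h1) j → jOf n h1 ls ≡ j
jOf≡Largest {n} {h1} {ls} = lastOr-filter≡Largest (λ p → expo n ls p ≟ 0) 0 (candidates-increasing n h1)

∸-2≡∸1-∸suc : ∀ n i → n ∸ i ∸ 2 ≡ n ∸ 1 ∸ suc i
∸-2≡∸1-∸suc n i = begin
  n ∸ i ∸ 2        ≡⟨ ∸-+-assoc n i 2 ⟩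
  n ∸ (i + 2)      ≡⟨ cong (n ∸_) (+-comm i 2) ⟩
  n ∸ (1 + suc i)  ≡⟨ sym (∸-+-assoc n 1 (suc i)) ⟩
  n ∸ 1 ∸ suc i    ∎
  where open ≡-Reasoning

at-applyUpTo : ∀ (f : ℕ → ℕ) {m t} → t < m → at (applyUpTo f m) t ≡ f t
at-applyUpTo f {suc m} {zero}  _         = refl
at-applyUpTo f {suc m} {suc t} (s≤s t<m) = at-applyUpTo (f ∘ suc) t<m

at-ext : ∀ xs ys → length xs ≡ length ys → (∀ t → t < length xs → at xs t ≡ at ys t) → xs ≡ ys
at-ext []       []       _   _     = refl
at-ext (x ∷ xs) (y ∷ ys) len≡ at≡ =
  cong₂ _∷_ (at≡ 0 (s≤s z≤n)) (at-ext xs ys (suc-injective len≡) (λ t t< → at≡ (suc t) (s≤s t<)))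

expo≡at : ∀ n ls {p} → p ≤ n → expo n ls p ≡ at ls (n ∸ p)
expo≡at n ls {p} p≤n = cong (at ls) (begin
  (n + 1) ∸ p ∸ 1  ≡⟨ cong (_∸ 1) (+-∸-comm 1 p≤n) ⟩
  (n ∸ p) + 1 ∸ 1  ≡⟨ m+n∸n≡m (n ∸ p) 1 ⟩
  n ∸ p            ∎)
  where open ≡-Reasoning

buildCol-∷ʳ-skip : ∀ n j ls is col → buildCol n j ls (is ∷ʳ j) col ≡ buildCol n j ls is col
buildCol-∷ʳ-skip n j ls []       col rewrite dec-true (j ≟ j) refl = refl
buildCol-∷ʳ-skip n j ls (i ∷ is) col with i ≡ᵇ j
... | true  = buildCol-∷ʳ-skip n j ls is col
... | false = buildCol-∷ʳ-skip n j ls is _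

buildCol-∷ʳ-insert : ∀ n j ls is col {i} → ¬ i ≡ j →
  let c = buildCol n j ls is col in buildCol n j ls (is ∷ʳ i) col ≡ insertAt (length c ∸ ((i ∸ 2) ∸ expo n ls i)) i c
buildCol-∷ʳ-insert n j ls []       col {i} i≢j rewrite dec-false (i ≟ j) i≢j = refl
buildCol-∷ʳ-insert n j ls (x ∷ is) col i≢j with x ≡ᵇ j
... | true  = buildCol-∷ʳ-insert n j ls is col i≢j
... | false = buildCol-∷ʳ-insert n j ls is _ i≢j

buildCol-range-skip : ∀ n j ls m col → 2 + m ≡ j →
                      buildCol n j ls (range 2 (suc m)) col ≡ buildCol n j ls (range 2 m) col
buildCol-range-skip n j ls m col 2+m≡j = begin
  buildCol n j ls (range 2 (suc m)) col       ≡⟨ cong (λ is → buildCol n j ls is col) (range-∷ʳ 2 m) ⟩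
  buildCol n j ls (range 2 m ∷ʳ (2 + m)) col  ≡⟨ cong (λ i → buildCol n j ls (range 2 m ∷ʳ i) col) 2+m≡j ⟩
  buildCol n j ls (range 2 m ∷ʳ j) col        ≡⟨ buildCol-∷ʳ-skip n j ls (range 2 m) col ⟩
  buildCol n j ls (range 2 m) col             ∎
  where open ≡-Reasoning

buildCol-range-insert : ∀ n j ls m col → ¬ 2 + m ≡ j →
  let c = buildCol n j ls (range 2 m) col
  in  buildCol n j ls (range 2 (suc m)) col ≡ insertAt (length c ∸ (m ∸ expo n ls (2 + m))) (2 + m) c
buildCol-range-insert n j ls m col 2+m≢j =
  trans (cong (λ is → buildCol n j ls is col) (range-∷ʳ 2 m)) (buildCol-∷ʳ-insert n j ls (range 2 m) col 2+m≢j)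

-- The exponent of x_p recorded by a P_h-tableau with bottom row 1 j and column 1 ∷ rest.
exponentOf : ℕ → List ℕ → ℕ → ℕ
exponentOf j rest p = if p ≡ᵇ j then 0 else (p ∸ 2) ∸ smallerAbove p rest

exponents : ℕ → ℕ → List ℕ → List ℕ
exponents n j rest = applyUpTo (λ t → exponentOf j rest (n ∸ t)) (n ∸ 1)

φT⁻¹ : ℕ → List (List ℕ) → List ℕ
φT⁻¹ n ((_ ∷ j ∷ []) ∷ rows) = exponents n j (concat rows)
φT⁻¹ n _                     = []

exponentOf-j : ∀ j rest → exponentOf j rest j ≡ 0
exponentOf-j j rest rewrite dec-true (j ≟ j) refl = refl

exponentOf-≢ : ∀ j rest {p} → ¬ p ≡ j → exponentOf j rest p ≡ (p ∸ 2) ∸ smallerAbove p rest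
exponentOf-≢ j rest {p} p≢j rewrite dec-false (p ≟ j) p≢j = refl

exponentOf≤ : ∀ j rest p → exponentOf j rest p ≤ p ∸ 2
exponentOf≤ j rest p with p ≡ᵇ j
... | true  = z≤n
... | false = m∸n≤m (p ∸ 2) (smallerAbove p rest)

expo-exponents : ∀ n j rest {p} → 2 ≤ p → p ≤ n → expo n (exponents n j rest) p ≡ exponentOf j rest p
expo-exponents n j rest {p} 2≤p p≤n = begin
  expo n (exponents n j rest) p    ≡⟨ expo≡at n (exponents n j rest) p≤n ⟩
  at (exponents n j rest) (n ∸ p)  ≡⟨ at-applyUpTo (λ t → exponentOf j rest (n ∸ t)) (∸-monoʳ-< 2≤p p≤n) ⟩
  exponentOf j rest (n ∸ (n ∸ p))  ≡⟨ cong (exponentOf j rest) (m∸[m∸n]≡n p≤n) ⟩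
  exponentOf j rest p              ∎
  where open ≡-Reasoning

-- From exponents to the column

module Encode {n j ls} (2≤j : 2 ≤ j) (j≤n : j ≤ n)
              (bounded : ∀ p → 2 ≤ p → p ≤ n → expo n ls p ≤ p ∸ 2)
              (positive : ∀ p → j < p → p ≤ n → 0 < expo n ls p) where

  private
    1≤n : 1 ≤ n
    1≤n = ≤-trans (s≤s z≤n) (≤-trans 2≤j j≤n)

  -- The column above 1 after the steps i = 2, …, m + 1 of buildCol.
  Encodes : ℕ → List ℕ → Set
  Encodes m rest = rest ↭ range 2 m ∖ j
                 × (∀ p → 2 ≤ p → p < 2 + m → ¬ p ≡ j → smallerAbove p rest ≡ (p ∸ 2) ∸ expo n ls p)

  -- Once j has been skipped the column is one entry short, but then the exponent is positive.
  depth≤height : ∀ m → 2 + m ≤ n → m ∸ expo n ls (2 + m) ≤ length (range 2 m ∖ j)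
  depth≤height m 2+m≤n with j <? 2 + m
  ... | yes j<2+m = begin
    m ∸ expo n ls (2 + m)   ≤⟨ ∸-monoʳ-≤ m (positive (2 + m) j<2+m 2+m≤n) ⟩
    m ∸ 1                   ≡⟨ cong (_∸ 1) (sym (length-range-∖-∈ 2 m j 2≤j j<2+m)) ⟩
    length (range 2 m ∖ j)  ∎
    where open ≤-Reasoning
  ... | no j≮2+m = begin
    m ∸ expo n ls (2 + m)   ≤⟨ m∸n≤m m (expo n ls (2 + m)) ⟩
    m                       ≡⟨ sym (length-range 2 m) ⟩
    length (range 2 m)      ≡⟨ cong length (sym (range-∖-∉ 2 m j (≮⇒≥ j≮2+m))) ⟩
    length (range 2 m ∖ j)  ∎
    where open ≤-Reasoning

  Encodes-skip : ∀ {m rest} → 2 + m ≡ j → Encodes m rest → Encodes (suc m) rest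
  Encodes-skip {m} {rest} 2+m≡j (perm , depths) = subst (rest ↭_) (sym range-suc-∖) perm , depths′
    where
    range-suc-∖ : range 2 (suc m) ∖ j ≡ range 2 m ∖ j
    range-suc-∖ = begin
      range 2 (suc m) ∖ j         ≡⟨ cong (_∖ j) (range-∷ʳ 2 m) ⟩
      (range 2 m ∷ʳ (2 + m)) ∖ j  ≡⟨ cong (λ i → (range 2 m ∷ʳ i) ∖ j) 2+m≡j ⟩
      (range 2 m ∷ʳ j) ∖ j        ≡⟨ ∷ʳ-∖-≡ (range 2 m) ⟩
      range 2 m ∖ j               ∎
      where open ≡-Reasoning
    depths′ : ∀ p → 2 ≤ p → p < 3 + m → ¬ p ≡ j → smallerAbove p rest ≡ (p ∸ 2) ∸ expo n ls p
    depths′ p 2≤p p<3+m p≢j =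
      depths p 2≤p (≤∧≢⇒< (≤-pred p<3+m) (λ p≡2+m → p≢j (trans p≡2+m 2+m≡j))) p≢j

  Encodes-insert : ∀ {m rest} → ¬ 2 + m ≡ j → m ∸ expo n ls (2 + m) ≤ length rest → Encodes m rest →
                   Encodes (suc m) (insertAt (length rest ∸ (m ∸ expo n ls (2 + m))) (2 + m) rest)
  Encodes-insert {m} {rest} i≢j a≤len (perm , depths) = perm′ , depths′
    where
    i = 2 + m
    a = m ∸ expo n ls i
    rest<i : All (_< i) rest
    rest<i = All-resp-↭ (↭-sym perm) (All.filter⁺ _ (All.map proj₂ (range-bounded 2 m)))
    perm′ : insertAt (length rest ∸ a) i rest ↭ range 2 (suc m) ∖ j
    perm′ = begin
      insertAt (length rest ∸ a) i rest  ↭⟨ insertAt-↭ (length rest ∸ a) i rest ⟩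
      i ∷ rest                           ↭⟨ prep i perm ⟩
      i ∷ range 2 m ∖ j                  ↭⟨ ∷↭∷ʳ i (range 2 m ∖ j) ⟩
      (range 2 m ∖ j) ∷ʳ i               ≡⟨ sym (∷ʳ-∖-≢ (range 2 m) i≢j) ⟩
      (range 2 m ∷ʳ i) ∖ j               ≡⟨ cong (_∖ j) (sym (range-∷ʳ 2 m)) ⟩
      range 2 (suc m) ∖ j                ∎
      where open PermutationReasoning
    depths′ : ∀ p → 2 ≤ p → p < 3 + m → ¬ p ≡ j →
             smallerAbove p (insertAt (length rest ∸ a) i rest) ≡ (p ∸ 2) ∸ expo n ls p
    depths′ p 2≤p p<3+m p≢j with p ≟ i
    ... | yes refl =
      trans (smallerAbove-insertAt-self (length rest ∸ a) i rest rest<i (m∸n≤m _ a)) (m∸[m∸n]≡n a≤len)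
    ... | no  p≢i  =
      trans (smallerAbove-insertAt-other p (length rest ∸ a) i rest p≢i (λ i<p → <⇒≱ i<p (≤-pred p<3+m)))
            (depths p 2≤p (≤∧≢⇒< (≤-pred p<3+m) p≢i) p≢j)

  encode : ∀ m → 1 + m ≤ n → ∃[ rest ] buildCol n j ls (range 2 m) (1 ∷ []) ≡ 1 ∷ rest × Encodes m rest
  encode zero    _     = [] , refl , ↭-refl , λ p 2≤p p<2 _ → ⊥-elim (<⇒≱ p<2 2≤p)
  encode (suc m) 2+m≤n with rest , col≡ , enc ← encode m (≤-trans (n≤1+n _) 2+m≤n) | 2 + m ≟ j
  ... | yes 2+m≡j = rest , trans (buildCol-range-skip n j ls m (1 ∷ []) 2+m≡j) col≡ , Encodes-skip 2+m≡j enc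
  ... | no  2+m≢j = insertAt (length rest ∸ a) (2 + m) rest , col′≡ , Encodes-insert 2+m≢j a≤len enc
    where
    a = m ∸ expo n ls (2 + m)
    a≤len : a ≤ length rest
    a≤len = subst (a ≤_) (sym (↭-length (proj₁ enc))) (depth≤height m 2+m≤n)
    col′≡ : buildCol n j ls (range 2 (suc m)) (1 ∷ []) ≡ 1 ∷ insertAt (length rest ∸ a) (2 + m) rest
    col′≡ = begin
      buildCol n j ls (range 2 (suc m)) (1 ∷ [])           ≡⟨ buildCol-range-insert n j ls m (1 ∷ []) 2+m≢j ⟩
      insertAt (length c ∸ a) (2 + m) c                    ≡⟨ cong (λ c → insertAt (length c ∸ a) (2 + m) c) col≡ ⟩
      insertAt (suc (length rest) ∸ a) (2 + m) (1 ∷ rest)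
        ≡⟨ cong (λ k → insertAt k (2 + m) (1 ∷ rest)) (+-∸-assoc 1 a≤len) ⟩
      1 ∷ insertAt (length rest ∸ a) (2 + m) rest          ∎
      where
      open ≡-Reasoning
      c = buildCol n j ls (range 2 m) (1 ∷ [])

  column : ∃[ rest ] buildCol n j ls [2‥ n ] (1 ∷ []) ≡ 1 ∷ rest × Encodes (n ∸ 1) rest
  column = subst (λ is → ∃[ rest ] buildCol n j ls is (1 ∷ []) ≡ 1 ∷ rest × Encodes (n ∸ 1) rest)
                 (sym ([2‥]≡range n)) (encode (n ∸ 1) (≤-reflexive (m+[n∸m]≡n 1≤n)))

  column-↭ : ∀ {rest} → Encodes (n ∸ 1) rest → rest ↭ [2‥ n ] ∖ j
  column-↭ (perm , _) = subst (λ xs → _ ↭ xs ∖ j) (sym ([2‥]≡range n)) perm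

  exponentOf-column : expo n ls j ≡ 0 → ∀ {rest} → Encodes (n ∸ 1) rest →
                      ∀ p → 2 ≤ p → p ≤ n → exponentOf j rest p ≡ expo n ls p
  exponentOf-column zero-at-j {rest} _ p 2≤p p≤n with p ≟ j
  ... | yes refl = trans (exponentOf-j j rest) (sym zero-at-j)
  exponentOf-column zero-at-j {rest} (_ , depths) p 2≤p p≤n | no p≢j = begin
    exponentOf j rest p                ≡⟨ exponentOf-≢ j rest p≢j ⟩
    (p ∸ 2) ∸ smallerAbove p rest      ≡⟨ cong ((p ∸ 2) ∸_) (depths p 2≤p p<2+[n∸1] p≢j) ⟩
    (p ∸ 2) ∸ ((p ∸ 2) ∸ expo n ls p)  ≡⟨ m∸[m∸n]≡n (bounded p 2≤p p≤n) ⟩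
    expo n ls p                        ∎
    where
    open ≡-Reasoning
    p<2+[n∸1] : p < 2 + (n ∸ 1)
    p<2+[n∸1] = subst (p <_) (sym (2+[n∸1]≡1+n 1≤n)) (s≤s p≤n)

  exponents-column : length ls ≡ n ∸ 1 → expo n ls j ≡ 0 →
                     ∀ {rest} → Encodes (n ∸ 1) rest → exponents n j rest ≡ ls
  exponents-column len≡ zero-at-j {rest} encodes =
    at-ext (exponents n j rest) ls (trans (length-applyUpTo _ (n ∸ 1)) (sym len≡)) at≡
    where
    at≡ : ∀ t → t < length (exponents n j rest) → at (exponents n j rest) t ≡ at ls t
    at≡ t t<len = begin
      at (exponents n j rest) t  ≡⟨ at-applyUpTo (λ t → exponentOf j rest (n ∸ t)) t< ⟩
      exponentOf j rest (n ∸ t)  ≡⟨ exponentOf-column zero-at-j encodes (n ∸ t) 2≤n∸t (m∸n≤m n t) ⟩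
      expo n ls (n ∸ t)          ≡⟨ expo≡at n ls (m∸n≤m n t) ⟩
      at ls (n ∸ (n ∸ t))        ≡⟨ cong (at ls) (m∸[m∸n]≡n (≤-trans (<⇒≤ t<) (m∸n≤m n 1))) ⟩
      at ls t                    ∎
      where
      open ≡-Reasoning
      t< : t < n ∸ 1
      t< = subst (t <_) (length-applyUpTo _ (n ∸ 1)) t<len
      2≤n∸t : 2 ≤ n ∸ t
      2≤n∸t = subst (_< n ∸ t) (m∸[m∸n]≡n 1≤n) (∸-monoʳ-< t< (m∸n≤m n 1))

-- From the column to exponents

module Decode {n j ds} (2≤j : 2 ≤ j) (j≤n : j ≤ n) (ds↭ : ds ↭ [2‥ n ] ∖ j) where

  private
    1≤n : 1 ≤ n
    1≤n = ≤-trans (s≤s z≤n) (≤-trans 2≤j j≤n)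

  ls : List ℕ
  ls = exponents n j ds

  ds-bounded : All (λ x → 2 ≤ x × x ≤ n) ds
  ds-bounded = All-resp-↭ (↭-sym ds↭) ([2‥]∖-bounded 1≤n j)

  ds-unique : Unique ds
  ds-unique = Unique-resp-↭ (↭⇒↭ₛ (↭-sym ds↭)) ([2‥]∖-unique 1≤n j)

  j∉ds : j ∉ ds
  j∉ds j∈ds = j∉[2‥]∖j 1≤n j (∈-resp-↭ ds↭ j∈ds)

  countSmaller-j∷ds : ∀ p → p ≤ n → countSmaller p (j ∷ ds) ≡ p ∸ 2
  countSmaller-j∷ds p p≤n =
    trans (countSmaller-↭ p (prep j ds↭)) (countSmaller-∷-[2‥]∖ 1≤n j 2≤j j≤n p (m≤n⇒m≤1+n p≤n))

  smallerAbove≤ : ∀ p → p ≤ n → smallerAbove p ds ≤ p ∸ 2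
  smallerAbove≤ p p≤n = begin
    smallerAbove p ds        ≤⟨ smallerAbove≤countSmaller p ds ⟩
    countSmaller p ds        ≤⟨ countSmaller-≤-∷ p j ds ⟩
    countSmaller p (j ∷ ds)  ≡⟨ countSmaller-j∷ds p p≤n ⟩
    p ∸ 2                    ∎
    where open ≤-Reasoning

  smallerAbove< : ∀ p → j < p → p ≤ n → smallerAbove p ds < p ∸ 2
  smallerAbove< p j<p p≤n = begin-strict
    smallerAbove p ds        ≤⟨ smallerAbove≤countSmaller p ds ⟩
    countSmaller p ds        <⟨ n<1+n _ ⟩
    suc (countSmaller p ds)  ≡⟨ sym (countSmaller-accept ds j<p) ⟩
    countSmaller p (j ∷ ds)  ≡⟨ countSmaller-j∷ds p p≤n ⟩
    p ∸ 2                    ∎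
    where open ≤-Reasoning

  expo-ls : ∀ {p} → 2 ≤ p → p ≤ n → ¬ p ≡ j → expo n ls p ≡ (p ∸ 2) ∸ smallerAbove p ds
  expo-ls 2≤p p≤n p≢j = trans (expo-exponents n j ds 2≤p p≤n) (exponentOf-≢ j ds p≢j)

  depth : ∀ {p} → 2 ≤ p → p ≤ n → ¬ p ≡ j → (p ∸ 2) ∸ expo n ls p ≡ smallerAbove p ds
  depth {p} 2≤p p≤n p≢j = begin
    (p ∸ 2) ∸ expo n ls p                    ≡⟨ cong ((p ∸ 2) ∸_) (expo-ls 2≤p p≤n p≢j) ⟩
    (p ∸ 2) ∸ ((p ∸ 2) ∸ smallerAbove p ds)  ≡⟨ m∸[m∸n]≡n (smallerAbove≤ p p≤n) ⟩
    smallerAbove p ds                        ∎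
    where open ≡-Reasoning

  reinsert : ∀ {i} → 2 ≤ i → i ≤ n → ¬ i ≡ j →
             let below = 1 ∷ filter (_<? i) ds
             in  insertAt (length below ∸ ((i ∸ 2) ∸ expo n ls i)) i below ≡ 1 ∷ filter (_<? suc i) ds
  reinsert {i} 2≤i i≤n i≢j = begin
    insertAt (suc (countSmaller i ds) ∸ ((i ∸ 2) ∸ expo n ls i)) i (1 ∷ filter (_<? i) ds)
      ≡⟨ cong (λ a → insertAt (suc (countSmaller i ds) ∸ a) i (1 ∷ filter (_<? i) ds)) (depth 2≤i i≤n i≢j) ⟩
    insertAt (suc (countSmaller i ds) ∸ smallerAbove i ds) i (1 ∷ filter (_<? i) ds)
      ≡⟨ cong (λ k → insertAt k i (1 ∷ filter (_<? i) ds)) (+-∸-assoc 1 (smallerAbove≤countSmaller i ds)) ⟩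
    1 ∷ insertAt (countSmaller i ds ∸ smallerAbove i ds) i (filter (_<? i) ds)
      ≡⟨ cong (1 ∷_) (sym (filter-<-suc≡insertAt i ds i∈ds ds-unique)) ⟩
    1 ∷ filter (_<? suc i) ds
      ∎
    where
    open ≡-Reasoning
    i∈ds : i ∈ ds
    i∈ds = ∈-resp-↭ (↭-sym ds↭) (∈-filter⁺ _ (∈-[2‥]⁺ 1≤n 2≤i i≤n) i≢j)

  decode : ∀ m → 1 + m ≤ n → buildCol n j ls (range 2 m) (1 ∷ []) ≡ 1 ∷ filter (_<? 2 + m) ds
  decode zero    _     = cong (1 ∷_) (sym (filter-none (_<? 2) (All.map (λ (2≤x , _) x<2 → <⇒≱ x<2 2≤x) ds-bounded)))
  decode (suc m) 2+m≤n with 2 + m ≟ j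
  ... | yes 2+m≡j = begin
    buildCol n j ls (range 2 (suc m)) (1 ∷ [])  ≡⟨ buildCol-range-skip n j ls m (1 ∷ []) 2+m≡j ⟩
    buildCol n j ls (range 2 m) (1 ∷ [])        ≡⟨ decode m (≤-trans (n≤1+n _) 2+m≤n) ⟩
    1 ∷ filter (_<? 2 + m) ds                   ≡⟨ cong (1 ∷_) (sym (filter-<-suc-∉ (2 + m) ds 2+m∉ds)) ⟩
    1 ∷ filter (_<? 3 + m) ds                   ∎
    where
    open ≡-Reasoning
    2+m∉ds : 2 + m ∉ ds
    2+m∉ds = subst (_∉ ds) (sym 2+m≡j) j∉ds
  ... | no  2+m≢j = begin
    buildCol n j ls (range 2 (suc m)) (1 ∷ [])       ≡⟨ buildCol-range-insert n j ls m (1 ∷ []) 2+m≢j ⟩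
    insertAt (length c ∸ (m ∸ expo n ls (2 + m))) (2 + m) c
      ≡⟨ cong (λ c → insertAt (length c ∸ (m ∸ expo n ls (2 + m))) (2 + m) c) (decode m (≤-trans (n≤1+n _) 2+m≤n)) ⟩
    insertAt (length below ∸ (m ∸ expo n ls (2 + m))) (2 + m) below
      ≡⟨ reinsert (s≤s (s≤s z≤n)) 2+m≤n 2+m≢j ⟩
    1 ∷ filter (_<? 3 + m) ds                        ∎
    where
    open ≡-Reasoning
    c = buildCol n j ls (range 2 m) (1 ∷ [])
    below = 1 ∷ filter (_<? 2 + m) ds

  column : buildCol n j ls [2‥ n ] (1 ∷ []) ≡ 1 ∷ ds
  column = begin
    buildCol n j ls [2‥ n ] (1 ∷ [])            ≡⟨ cong (λ is → buildCol n j ls is (1 ∷ [])) ([2‥]≡range n) ⟩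
    buildCol n j ls (range 2 (n ∸ 1)) (1 ∷ [])  ≡⟨ decode (n ∸ 1) (≤-reflexive (m+[n∸m]≡n 1≤n)) ⟩
    1 ∷ filter (_<? 2 + (n ∸ 1)) ds             ≡⟨ cong (1 ∷_) (filter-all (_<? 2 + (n ∸ 1)) ds<2+[n∸1]) ⟩
    1 ∷ ds                                      ∎
    where
    open ≡-Reasoning
    ds<2+[n∸1] : All (_< 2 + (n ∸ 1)) ds
    ds<2+[n∸1] = All.map (λ {x} (_ , x≤n) → subst (x <_) (sym (2+[n∸1]≡1+n 1≤n)) (s≤s x≤n)) ds-bounded

  zero-at-j : expo n ls j ≡ 0
  zero-at-j = trans (expo-exponents n j ds 2≤j j≤n) (exponentOf-j j ds)

  positive-above-j : ∀ p → j < p → p ≤ n → 0 < expo n ls p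
  positive-above-j p j<p p≤n = subst (0 <_) (sym (expo-ls 2≤p p≤n (>⇒≢ j<p)))
    (m<n⇒0<n∸m (smallerAbove< p j<p p≤n))
    where
    2≤p : 2 ≤ p
    2≤p = ≤-trans 2≤j (<⇒≤ j<p)

  ls∈B3 : ∀ {h1 k} → h1 < j → 2 ≤ k → k ≤ n → InB3 n h1 ls k
  ls∈B3 h1<j 2≤k k≤n = length-applyUpTo _ (n ∸ 1) , bounded , 2≤k , k≤n ,
    λ all-positive → <⇒≢ (all-positive j h1<j j≤n) (sym zero-at-j)
    where
    bounded : ∀ t → 1 ≤ t → t ≤ n ∸ 1 → ell ls t ≤ n ∸ 1 ∸ t
    bounded (suc i) _ i<n∸1 = begin
      at ls i                  ≡⟨ at-applyUpTo (λ t → exponentOf j ds (n ∸ t)) i<n∸1 ⟩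
      exponentOf j ds (n ∸ i)  ≤⟨ exponentOf≤ j ds (n ∸ i) ⟩
      n ∸ i ∸ 2                ≡⟨ ∸-2≡∸1-∸suc n i ⟩
      n ∸ 1 ∸ suc i            ∎
      where open ≤-Reasoning

  jOf-ls : ∀ {h1} → h1 < j → jOf n h1 ls ≡ j
  jOf-ls {h1} h1<j = jOf≡Largest {n} {h1} {ls} (∈-candidates⁺ h1<j j≤n , zero-at-j ,
    λ y∈ j<y y-zero → <⇒≢ (positive-above-j _ j<y (proj₂ (∈-candidates⁻ {n} {h1} y∈))) (sym y-zero))

  φT-ls : ∀ {h1} → h1 < j → φT n h1 ls ≡ hook 1 j ds
  φT-ls {h1} h1<j = begin
    φT n h1 ls
      ≡⟨ cong (λ j′ → hookRows 1 j′ (buildCol n j′ ls [2‥ n ] (1 ∷ []))) (jOf-ls h1<j) ⟩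
    hookRows 1 j (buildCol n j ls [2‥ n ] (1 ∷ []))  ≡⟨ cong (hookRows 1 j) column ⟩
    hook 1 j ds                                      ∎
    where open ≡-Reasoning

InB3-bounded : ∀ {n h1 ls k} → InB3 n h1 ls k → ∀ p → 2 ≤ p → p ≤ n → expo n ls p ≤ p ∸ 2
InB3-bounded {n} {ls = ls} (_ , ell-bounded , _) p 2≤p p≤n = begin
  expo n ls p          ≡⟨ expo≡at n ls p≤n ⟩
  at ls (n ∸ p)        ≤⟨ ell-bounded (suc (n ∸ p)) (s≤s z≤n) (∸-monoʳ-< 2≤p p≤n) ⟩
  n ∸ 1 ∸ suc (n ∸ p)  ≡⟨ sym (∸-2≡∸1-∸suc n (n ∸ p)) ⟩
  n ∸ (n ∸ p) ∸ 2      ≡⟨ cong (_∸ 2) (m∸[m∸n]≡n p≤n) ⟩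
  p ∸ 2                ∎
  where open ≤-Reasoning

module _ {n h1 ls k} (1≤h1 : 1 ≤ h1) (ls∈B3 : InB3 n h1 ls k) where

  private
    j = jOf n h1 ls
    j-largest : Largest (ZeroExponent n ls) (candidates n h1) j
    j-largest = jOf-Largest {n} {h1} {ls} {k} ls∈B3
    h1<j : h1 < j
    h1<j = proj₁ (∈-candidates⁻ {n} {h1} (proj₁ j-largest))
    j≤n : j ≤ n
    j≤n = proj₂ (∈-candidates⁻ {n} {h1} (proj₁ j-largest))

    positive : ∀ p → j < p → p ≤ n → 0 < expo n ls p
    positive p j<p p≤n = n≢0⇒n>0 (proj₂ (proj₂ j-largest) (∈-candidates⁺ (<-trans h1<j j<p) p≤n) j<p)

    2≤j : 2 ≤ j
    2≤j = ≤-trans (s≤s 1≤h1) h1<j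

    open Encode {n} {j} {ls} 2≤j j≤n (InB3-bounded {n} {h1} {ls} {k} ls∈B3) positive

  φT-PhTableau : PTableau (Ph n h1) n (μ n) (φT n h1 ls)
  φT-PhTableau with rest , col≡ , encodes ← column =
    subst (PTableau (Ph n h1) n (μ n) ∘ hookRows 1 j) (sym col≡)
          (hook-PhTableau (≤-trans (s≤s z≤n) (≤-trans 2≤j j≤n)) 1≤h1 h1<j j≤n (column-↭ encodes))

  φT⁻¹-φT : φT⁻¹ n (φT n h1 ls) ≡ ls
  φT⁻¹-φT with rest , col≡ , encodes ← column = begin
    φT⁻¹ n (φT n h1 ls)                       ≡⟨ cong (φT⁻¹ n ∘ hookRows 1 j) col≡ ⟩
    exponents n j (concat (singletons rest))  ≡⟨ cong (exponents n j) (concat-singletons rest) ⟩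
    exponents n j rest                        ≡⟨ exponents-column (proj₁ ls∈B3) (proj₁ (proj₂ j-largest)) encodes ⟩
    ls                                        ∎
    where open ≡-Reasoning

theoremC : (n h1 : ℕ) → 2 ≤ n → 1 ≤ h1 → h1 ≤ n →
    -- φ is well defined as a map B_3 → {(S,T)}
    ((ls : List ℕ) (k : ℕ) → InB3 n h1 ls k →
        SYT n (μ n) (proj₁ (φ n h1 ls k)) × PTableau (Ph n h1) n (μ n) (proj₂ (φ n h1 ls k)))
    -- φ is injective on B_3
    × ((ls ls′ : List ℕ) (k k′ : ℕ) → InB3 n h1 ls k → InB3 n h1 ls′ k′ →
        φ n h1 ls k ≡ φ n h1 ls′ k′ → (ls ≡ ls′) × (k ≡ k′))
    -- φ is surjective
    × ((S T : List (List ℕ)) → SYT n (μ n) S → PTableau (Ph n h1) n (μ n) T →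
        ∃[ ls ] ∃[ k ] (InB3 n h1 ls k × φ n h1 ls k ≡ (S , T)))
theoremC n h1 2≤n 1≤h1 _ = well-defined , injective , surjective
  where
  1≤n : 1 ≤ n
  1≤n = <⇒≤ 2≤n

  well-defined : ∀ ls k → InB3 n h1 ls k →
                 SYT n (μ n) (φS n k) × PTableau (Ph n h1) n (μ n) (φT n h1 ls)
  well-defined ls k ls∈B3@(_ , _ , 2≤k , k≤n , _) = φS-SYT 1≤n 2≤k k≤n , φT-PhTableau 1≤h1 ls∈B3

  injective : ∀ ls ls′ k k′ → InB3 n h1 ls k → InB3 n h1 ls′ k′ →
              φ n h1 ls k ≡ φ n h1 ls′ k′ → ls ≡ ls′ × k ≡ k′
  injective ls ls′ k k′ ls∈B3 ls′∈B3 φ≡ =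
    ls≡ls′ , ∷-injectiveˡ (∷-injectiveʳ (∷-injectiveˡ (cong proj₁ φ≡)))
    where
    ls≡ls′ : ls ≡ ls′
    ls≡ls′ = begin
      ls                    ≡⟨ sym (φT⁻¹-φT 1≤h1 ls∈B3) ⟩
      φT⁻¹ n (φT n h1 ls)   ≡⟨ cong (φT⁻¹ n ∘ proj₂) φ≡ ⟩
      φT⁻¹ n (φT n h1 ls′)  ≡⟨ φT⁻¹-φT 1≤h1 ls′∈B3 ⟩
      ls′                   ∎
      where open ≡-Reasoning

  surjective : ∀ S T → SYT n (μ n) S → PTableau (Ph n h1) n (μ n) T →
               ∃[ ls ] ∃[ k ] (InB3 n h1 ls k × φ n h1 ls k ≡ (S , T))
  surjective S T S-SYT T-Ph
    with k , 2≤k , k≤n , refl ← SYT⇒φS 1≤n S S-SYT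
       | j , ds , h1<j , j≤n , ds↭ , refl ← PhTableau⇒hook 1≤n 1≤h1 T T-Ph
    = ls , k , ls∈B3 h1<j 2≤k k≤n , cong (φS n k ,_) (φT-ls h1<j)
    where open Decode (≤-trans (s≤s 1≤h1) h1<j) j≤n ds↭
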